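{- For every $n$, there is an injection from $\bar{Q}_5(0,n)$ to $P_8(0,n)$.
   Context: Partitions: $\ell(\mu)$ is the number of parts, $s(\mu)$ the smallest part ($s(\emptyset)=+\infty$), $\mu_i=0$ if $\mu$ has fewer than $i$ parts, rank of $\lambda$ is $\lambda_1-\ell(\lambda)$. The rank-set of $\lambda=(\lambda_1\ge\cdots\ge\lambda_\ell>0)$ is $[-\lambda_1,1-\lambda_2,\ldots,\ell-1-\lambda_\ell,\ell,\ell+1,\ldots]$. The Durfee symbol of $\lambda$ is $(\alpha,\beta)_j$, where $j$ is the side of the Durfee square (largest $j$ with $\lambda_j\ge j$, or $0$), $\alpha_i=\lambda'_{j+i}$ are the column lengths to the right of the Durfee square ($\lambda'$ the conjugate) and $\beta=(\lambda_{j+1},\lambda_{j+2},\ldots)$ are the rows below it. $Q(0,n)$ is the set of partitions of $n$ with $0$ in the rank-set; $P(0,n)$ the set of partitions of $n$ with rank $\ge0$. $\bar{Q}_5(0,n)$ is the set of $\lambda\in Q(0,n)$ whose Durfee symbol satisfies $j\ge1$, $\ell(\beta)-\ell(\alpha)\ge1$, $\alpha_1=\alpha_2=j$, $s(\alpha)\ge2$, $\beta_1>\beta_2$ and $s(\beta)=2$. $P_8(0,n)$ is the set of $\mu\in P(0,n)$ whose Durfee symbol $(\gamma,\delta)_{j'}$ satisfies $j'\ge1$, $\ell(\gamma)=\ell(\delta)$, $\gamma_1=\gamma_2=j'-1$, $\delta_1=j'$, and $\delta$ has no part equal to $2$. -}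

module Defs where

open import Data.Nat using (ℕ; zero; suc; _+_; _∸_; _≤_; _<_; _≥_; _>_; _⊔_; _⊓_; _≤?_)
open import Data.Integer as ℤ using (ℤ; +_)
open import Data.Nat.ListAction using (sum)
open import Data.List using (List; []; _∷_; length; filter; drop; map; upTo)
open import Data.List.Relation.Unary.All using (All)
open import Data.List.Relation.Unary.Linked using (Linked)
open import Data.List.Membership.Propositional using (_∈_)
open import Data.Maybe using (Maybe; just; nothing)
open import Data.Product using (Σ; _×_; ∃-syntax)
open import Data.Sum using (_⊎_)
open import Data.Unit using (⊤)
open import Relation.Nullary using (¬_)
open import Relation.Binary.PropositionalEquality using (_≡_)

IsPartition : ℕ → List ℕ → Set
IsPartition n μ = Linked _≥_ μ × All (0 <_) μ × sum μ ≡ n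

-- 0-indexed entry with default 0:  at μ (i - 1) = μ_i  (μ_i = 0 beyond ℓ(μ)).
at : List ℕ → ℕ → ℕ
at []       _       = 0
at (x ∷ _)  zero    = x
at (_ ∷ xs) (suc i) = at xs i

ℓ : List ℕ → ℕ
ℓ = length

-- s(μ): smallest part, with nothing standing for +∞ (s(∅) = +∞).
smallest : List ℕ → Maybe ℕ
smallest []       = nothing
smallest (x ∷ xs) with smallest xs
... | nothing = just x
... | just m  = just (x ⊓ m)

SmallestGe : List ℕ → ℕ → Set
SmallestGe μ k with smallest μ
... | nothing = ⊤
... | just m  = k ≤ m

rank : List ℕ → ℤ
rank μ = + at μ 0 ℤ.- + ℓ μ

-- membership in the rank-set [-λ₁, 1-λ₂, …, ℓ-1-λ_ℓ, ℓ, ℓ+1, …]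
-- (the entry at 0-indexed position i < ℓ is i - λ_{i+1}).
InRankSet : ℤ → List ℕ → Set
InRankSet z μ = (∃[ i ] (i < ℓ μ × z ≡ + i ℤ.- + at μ i)) ⊎ (+ ℓ μ ℤ.≤ z)

conj : List ℕ → ℕ → ℕ
conj μ k = length (filter (k ≤?_) μ)

-- side of the Durfee square: largest j ∈ {1..ℓ} with λ_j ≥ j, or 0.
durfeeFrom : ℕ → List ℕ → ℕ
durfeeFrom _ []       = 0
durfeeFrom i (x ∷ xs) with suc i ≤? x
... | Relation.Nullary.yes _ = suc i ⊔ durfeeFrom (suc i) xs
... | Relation.Nullary.no  _ = durfeeFrom (suc i) xs

durfee : List ℕ → ℕ
durfee = durfeeFrom 0

-- Durfee symbol (α, β)_j:
-- α_i = λ'_{j+i} for i = 1 .. λ₁ - j (the nonzero columns right of the square),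
-- β = (λ_{j+1}, λ_{j+2}, …).
durfeeα : List ℕ → List ℕ
durfeeα μ = map (λ i → conj μ (durfee μ + suc i)) (upTo (at μ 0 ∸ durfee μ))

durfeeβ : List ℕ → List ℕ
durfeeβ μ = drop (durfee μ) μ

InQ0 : ℕ → List ℕ → Set
InQ0 n μ = IsPartition n μ × InRankSet (+ 0) μ

InP0 : ℕ → List ℕ → Set
InP0 n μ = IsPartition n μ × (+ 0 ℤ.≤ rank μ)

InQbar5 : ℕ → List ℕ → Set
InQbar5 n μ =
  InQ0 n μ ×
  1 ≤ j ×
  1 + ℓ α ≤ ℓ β ×
  at α 0 ≡ j × at α 1 ≡ j ×
  SmallestGe α 2 ×
  at β 0 > at β 1 ×
  smallest β ≡ just 2
  where
  j = durfee μ
  α = durfeeα μ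
  β = durfeeβ μ

InP8 : ℕ → List ℕ → Set
InP8 n μ =
  InP0 n μ ×
  1 ≤ j ×
  ℓ γ ≡ ℓ δ ×
  at γ 0 ≡ j ∸ 1 × at γ 1 ≡ j ∸ 1 ×
  at δ 0 ≡ j ×
  ¬ (2 ∈ δ)
  where
  j = durfee μ
  γ = durfeeα μ
  δ = durfeeβ μ

-- Write j for the Durfee side of λ ∈ Q̄₅(0,n), w = λ_j, h = λ₁ and m = ℓ(β). The conditions
-- α₂ = j and 0 ∈ rank-set force λ_j ≥ j + 2 and λ_{j+1} = β₁ = j, so β'₁ = β'₂ = m, β'_j = 1,
-- and the columns of λ are λ'_k = j + β'_k for k ≤ j, λ'_k = j for j < k ≤ w, and
-- 2 ≤ λ'_k < j for w < k ≤ h. The image of λ has the rows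
--   w+m−1, w+β'₃, w−1+β'₄, …, w−1+β'_j, j, j, 1+λ'_{w+1}, …, 1+λ'_h, 1, …, 1,
-- with as many parts 1 as make its rank zero. Counting λ by columns shows that the image is a
-- partition of n; its Durfee side is again j, its two columns right of the square have length
-- j − 1 and no part 2 lies below the square, so it lies in P₈(0,n). Conversely the image
-- determines j, w, m, every β'_k and, after stripping the ones, every λ'_k with k > w, hence
-- all columns of λ and so λ itself.

module Submission where

open import Defs
open import Data.Nat
open import Data.Nat.Properties
open import Data.Nat.ListAction using (sum)
open import Data.Nat.ListAction.Properties using (sum-++)
open import Data.Nat.Tactic.RingSolver using (solve-∀)
import Data.Integer as ℤ
import Data.Integer.Properties as ℤₚ
open import Data.List using (List; []; _∷_; length; filter; drop; take; upTo; applyUpTo; _++_; replicate)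
open import Data.List.Properties
  using (∷-injectiveˡ; ∷-injectiveʳ; length-++; length-map; length-upTo; length-applyUpTo; length-take; length-drop; length-replicate;
         map-upTo; take++drop≡id; drop-drop; filter-accept; filter-reject; filter-all; filter-none; filter-++; filter-notAll)
open import Data.List.Relation.Unary.All as All using (All; []; _∷_)
open import Data.List.Relation.Unary.All.Properties using (++⁺; applyUpTo⁺₁; applyUpTo⁺₂; replicate⁺)
open import Data.List.Relation.Unary.Any as Any using (here; there)
open import Data.List.Relation.Unary.Linked as Linked using (Linked; []; [-]; _∷_)
open import Data.List.Relation.Unary.Linked.Properties using (Linked⇒All) renaming (applyUpTo⁺₂ to Linked-applyUpTo⁺)
open import Data.List.Membership.Propositional using (_∈_)
open import Data.Maybe using (just; nothing)
open import Data.Product using (Σ; _×_; _,_; proj₁; proj₂)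
open import Data.Sum using (inj₁; inj₂)
open import Function using (_∘_)
open import Algebra.Properties.CommutativeSemigroup +-commutativeSemigroup using (interchange)
open import Relation.Binary.Definitions using (tri<; tri≈; tri>)
open import Relation.Binary.PropositionalEquality
open import Relation.Nullary using (¬_; yes; no; contradiction)

Sorted : List ℕ → Set
Sorted = Linked _≥_

≤-head : ∀ {xs} → Sorted xs → All (_≤ at xs 0) xs
≤-head {[]}    _ = []
≤-head {_ ∷ _} s = Linked⇒All (λ y≤x z≤y → ≤-trans z≤y y≤x) ≤-refl s

sorted-drop : ∀ k {xs} → Sorted xs → Sorted (drop k xs)
sorted-drop zero    s = s
sorted-drop (suc k) {[]}    s = s
sorted-drop (suc k) {_ ∷ _} s = sorted-drop k (Linked.tail s)

sorted-∷ : ∀ {x ys} → All (_≤ x) ys → Sorted ys → Sorted (x ∷ ys)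
sorted-∷ []      _ = [-]
sorted-∷ (p ∷ _) s = p ∷ s

sorted-++ : ∀ b {xs ys} → Sorted xs → Sorted ys → All (b ≤_) xs → All (_≤ b) ys → Sorted (xs ++ ys)
sorted-++ b {[]}     _  sy _        _  = sy
sorted-++ b {x ∷ xs} sx sy (b≤x ∷ ps) qs =
  sorted-∷ (++⁺ (All.tail (≤-head sx)) (All.map (λ y≤b → ≤-trans y≤b b≤x) qs)) (sorted-++ b (Linked.tail sx) sy ps qs)

sorted-replicate : ∀ r x → Sorted (replicate r x)
sorted-replicate zero          x = []
sorted-replicate (suc zero)    x = [-]
sorted-replicate (suc (suc r)) x = ≤-refl ∷ sorted-replicate (suc r) x

at-≤ : ∀ {b} xs i → All (_≤ b) xs → at xs i ≤ b
at-≤ []       i       _        = z≤n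
at-≤ (x ∷ xs) zero    (p ∷ _)  = p
at-≤ (x ∷ xs) (suc i) (_ ∷ ps) = at-≤ xs i ps

at-antitone : ∀ {xs i k} → Sorted xs → i ≤ k → at xs k ≤ at xs i
at-antitone {[]}     _ _ = z≤n
at-antitone {x ∷ xs} {zero}  {k}     s _         = at-≤ (x ∷ xs) k (≤-head s)
at-antitone {x ∷ xs} {suc i} {suc k} s (s≤s i≤k) = at-antitone (Linked.tail s) i≤k

All⇒at : ∀ {P : ℕ → Set} {xs} i → All P xs → i < length xs → P (at xs i)
All⇒at zero    (p ∷ _)  _         = p
All⇒at (suc i) (_ ∷ ps) (s≤s i<l) = All⇒at i ps i<l

at⇒All : ∀ {P : ℕ → Set} xs → (∀ i → i < length xs → P (at xs i)) → All P xs
at⇒All []       _ = []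
at⇒All (x ∷ xs) h = h 0 z<s ∷ at⇒All xs (λ i i<l → h (suc i) (s≤s i<l))

at>0⇒<length : ∀ xs i → 0 < at xs i → i < length xs
at>0⇒<length (x ∷ xs) zero    _ = z<s
at>0⇒<length (x ∷ xs) (suc i) p = s≤s (at>0⇒<length xs i p)

at-++ˡ : ∀ xs ys {i} → i < length xs → at (xs ++ ys) i ≡ at xs i
at-++ˡ (x ∷ xs) ys {zero}  _         = refl
at-++ˡ (x ∷ xs) ys {suc i} (s≤s i<l) = at-++ˡ xs ys i<l

at-++ʳ : ∀ xs ys i → at (xs ++ ys) (length xs + i) ≡ at ys i
at-++ʳ []       ys i = refl
at-++ʳ (x ∷ xs) ys i = at-++ʳ xs ys i

at-drop : ∀ j xs k → at (drop j xs) k ≡ at xs (j + k)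
at-drop zero    xs       k = refl
at-drop (suc j) []       k = refl
at-drop (suc j) (x ∷ xs) k = at-drop j xs k

at-take : ∀ j xs {i} → i < j → at (take j xs) i ≡ at xs i
at-take (suc j) []       _                 = refl
at-take (suc j) (x ∷ xs) {zero}  _         = refl
at-take (suc j) (x ∷ xs) {suc i} (s≤s i<j) = at-take j xs i<j

at-applyUpTo : ∀ f n {i} → i < n → at (applyUpTo f n) i ≡ f i
at-applyUpTo f (suc n) {zero}  _         = refl
at-applyUpTo f (suc n) {suc i} (s≤s i<n) = at-applyUpTo (f ∘ suc) n i<n

at-injective : ∀ {xs ys} → All (0 <_) xs → All (0 <_) ys → (∀ i → at xs i ≡ at ys i) → xs ≡ ys
at-injective []       []       _ = refl
at-injective []       (q ∷ _)  h = contradiction (h 0) (<⇒≢ q)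
at-injective (p ∷ _)  []       h = contradiction (sym (h 0)) (<⇒≢ p)
at-injective (p ∷ ps) (q ∷ qs) h = cong₂ _∷_ (h 0) (at-injective ps qs (h ∘ suc))

drop-++ : ∀ (xs ys : List ℕ) → drop (length xs) (xs ++ ys) ≡ ys
drop-++ []       ys = refl
drop-++ (x ∷ xs) ys = drop-++ xs ys

sum-replicate : ∀ r x → sum (replicate r x) ≡ r * x
sum-replicate zero    x = refl
sum-replicate (suc r) x = cong (x +_) (sum-replicate r x)

++-ones-injective : ∀ {xs ys} r s → All (2 ≤_) xs → All (2 ≤_) ys →
                    xs ++ replicate r 1 ≡ ys ++ replicate s 1 → xs ≡ ys
++-ones-injective {[]}     {[]}     _       _       _        _        _ = refl
++-ones-injective {[]}     {y ∷ _}  (suc _) _       _        (2≤y ∷ _) e = contradiction (∷-injectiveˡ e) (<⇒≢ 2≤y)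
++-ones-injective {x ∷ _}  {[]}     _       (suc _) (2≤x ∷ _) _        e = contradiction (sym (∷-injectiveˡ e)) (<⇒≢ 2≤x)
++-ones-injective {x ∷ xs} {y ∷ ys} r       s       (_ ∷ ps) (_ ∷ qs)  e =
  cong₂ _∷_ (∷-injectiveˡ e) (++-ones-injective r s ps qs (∷-injectiveʳ e))

-- Conjugates

conj-∷⁺ : ∀ {k x} xs → k ≤ x → conj (x ∷ xs) k ≡ suc (conj xs k)
conj-∷⁺ {k} xs k≤x = cong length (filter-accept (k ≤?_) {xs = xs} k≤x)

conj-∷⁻ : ∀ {k x} xs → ¬ k ≤ x → conj (x ∷ xs) k ≡ conj xs k
conj-∷⁻ {k} xs k≰x = cong length (filter-reject (k ≤?_) {xs = xs} k≰x)

conj-++ : ∀ k xs ys → conj (xs ++ ys) k ≡ conj xs k + conj ys k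
conj-++ k xs ys = trans (cong length (filter-++ (k ≤?_) xs ys)) (length-++ (filter (k ≤?_) xs))

conj-all : ∀ {k xs} → All (k ≤_) xs → conj xs k ≡ length xs
conj-all {k} ps = cong length (filter-all (k ≤?_) ps)

conj-none : ∀ {k xs} → All (_< k) xs → conj xs k ≡ 0
conj-none {k} ps = cong length (filter-none (k ≤?_) (All.map <⇒≱ ps))

conj<length : ∀ {k y xs} → y < k → y ∈ xs → conj xs k < length xs
conj<length {k} y<k y∈xs = filter-notAll (k ≤?_) _ (Any.map (λ { refl → <⇒≱ y<k }) y∈xs)

conj-antitone : ∀ {k k′} xs → k ≤ k′ → conj xs k′ ≤ conj xs k
conj-antitone [] _ = z≤n
conj-antitone {k} {k′} (x ∷ xs) k≤k′ with k′ ≤? x | k ≤? x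
... | yes k′≤x | yes k≤x rewrite conj-∷⁺ xs k′≤x | conj-∷⁺ xs k≤x = s≤s (conj-antitone xs k≤k′)
... | yes k′≤x | no k≰x  = contradiction (≤-trans k≤k′ k′≤x) k≰x
... | no k′≰x  | yes k≤x rewrite conj-∷⁻ xs k′≰x | conj-∷⁺ xs k≤x = m≤n⇒m≤1+n (conj-antitone xs k≤k′)
... | no k′≰x  | no k≰x  rewrite conj-∷⁻ xs k′≰x | conj-∷⁻ xs k≰x = conj-antitone xs k≤k′

<conj⇒≤at : ∀ {xs i k} → Sorted xs → i < conj xs k → k ≤ at xs i
<conj⇒≤at {x ∷ xs} {i} {k} s i<c with k ≤? x
<conj⇒≤at {x ∷ xs} {zero}  s _   | yes k≤x = k≤x
<conj⇒≤at {x ∷ xs} {suc i} s i<c | yes k≤x =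
  <conj⇒≤at (Linked.tail s) (s≤s⁻¹ (subst (suc i <_) (conj-∷⁺ xs k≤x) i<c))
<conj⇒≤at {x ∷ xs} {i} {k} s i<c | no k≰x = contradiction (subst (i <_) tail-none i<c) n≮0
  where
  tail-none : conj (x ∷ xs) k ≡ 0
  tail-none = trans (conj-∷⁻ xs k≰x) (conj-none (All.map (λ y≤x → ≤-<-trans y≤x (≰⇒> k≰x)) (All.tail (≤-head s))))

≤at⇒<conj : ∀ {xs i k} → Sorted xs → suc k ≤ at xs i → i < conj xs (suc k)
≤at⇒<conj {x ∷ xs} {zero}  _ k<x = subst (0 <_) (sym (conj-∷⁺ xs k<x)) z<s
≤at⇒<conj {x ∷ xs} {suc i} s k<y =
  subst (suc i <_) (sym (conj-∷⁺ xs (≤-trans k<y (at-≤ xs i (All.tail (≤-head s)))))) (s≤s (≤at⇒<conj (Linked.tail s) k<y))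

conj-injective : ∀ {xs ys} → Sorted xs → Sorted ys → All (0 <_) xs → All (0 <_) ys →
                 (∀ k → conj xs (suc k) ≡ conj ys (suc k)) → xs ≡ ys
conj-injective sx sy px py h = at-injective px py (λ i → ≤-antisym (at-≤-at sx sy h i) (at-≤-at sy sx (sym ∘ h) i))
  where
  at-≤-at : ∀ {xs ys} → Sorted xs → Sorted ys → (∀ k → conj xs (suc k) ≡ conj ys (suc k)) → ∀ i → at xs i ≤ at ys i
  at-≤-at {xs} sx sy h i with at xs i in eq
  ... | zero  = z≤n
  ... | suc k = <conj⇒≤at sy (subst (i <_) (h k) (≤at⇒<conj sx (≤-reflexive (sym eq))))

conj-peak : ∀ {b} xs → Sorted xs → at xs 0 ≡ b → at xs 1 < b → conj xs b ≡ 1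
conj-peak []       _ refl ()
conj-peak (x ∷ xs) s refl x₂<x =
  trans (conj-∷⁺ xs ≤-refl) (cong suc (conj-none (All.map (λ y≤x₂ → ≤-<-trans y≤x₂ x₂<x) (≤-head (Linked.tail s)))))

Σ< : ℕ → (ℕ → ℕ) → ℕ
Σ< n f = sum (applyUpTo f n)

Σ<-split : ∀ a b f → Σ< (a + b) f ≡ Σ< a f + Σ< b (λ i → f (a + i))
Σ<-split zero    b f = refl
Σ<-split (suc a) b f = trans (cong (f 0 +_) (Σ<-split a b (f ∘ suc))) (sym (+-assoc (f 0) _ _))

Σ<-cong : ∀ {f g} n → (∀ {i} → i < n → f i ≡ g i) → Σ< n f ≡ Σ< n g
Σ<-cong zero    _ = refl
Σ<-cong (suc n) h = cong₂ _+_ (h z<s) (Σ<-cong n (h ∘ s≤s))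

Σ<-const : ∀ n c → Σ< n (λ _ → c) ≡ n * c
Σ<-const zero    c = refl
Σ<-const (suc n) c = cong (c +_) (Σ<-const n c)

Σ<-+ : ∀ n f g → Σ< n (λ i → f i + g i) ≡ Σ< n f + Σ< n g
Σ<-+ zero    f g = refl
Σ<-+ (suc n) f g = trans (cong (f 0 + g 0 +_) (Σ<-+ n (f ∘ suc) (g ∘ suc))) (interchange (f 0) (g 0) _ _)

Σ<-conj-singleton : ∀ x {K} → x ≤ K → Σ< K (λ i → conj (x ∷ []) (suc i)) ≡ x
Σ<-conj-singleton x {K} x≤K = begin
  Σ< K column                                       ≡⟨ cong (λ n → Σ< n column) (sym (m+[n∸m]≡n x≤K)) ⟩
  Σ< (x + (K ∸ x)) column                           ≡⟨ Σ<-split x (K ∸ x) column ⟩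
  Σ< x column + Σ< (K ∸ x) (λ i → column (x + i))
    ≡⟨ cong₂ _+_ (Σ<-cong x (conj-∷⁺ [])) (Σ<-cong (K ∸ x) (λ {i} _ → conj-∷⁻ [] (<⇒≱ (s≤s (m≤m+n x i))))) ⟩
  Σ< x (λ _ → 1) + Σ< (K ∸ x) (λ _ → 0)
    ≡⟨ cong₂ _+_ (trans (Σ<-const x 1) (*-identityʳ x)) (trans (Σ<-const (K ∸ x) 0) (*-zeroʳ (K ∸ x))) ⟩
  x + 0                                             ≡⟨ +-identityʳ x ⟩
  x                                                 ∎
  where
  open ≡-Reasoning
  column : ℕ → ℕ
  column i = conj (x ∷ []) (suc i)

sum≡Σ<conj : ∀ K {xs} → All (_≤ K) xs → sum xs ≡ Σ< K (λ i → conj xs (suc i))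
sum≡Σ<conj K []              = sym (trans (Σ<-const K 0) (*-zeroʳ K))
sum≡Σ<conj K {x ∷ xs} (x≤K ∷ ps) = sym (begin
  Σ< K (λ i → conj (x ∷ xs) (suc i))                              ≡⟨ Σ<-cong K (λ {i} _ → conj-++ (suc i) (x ∷ []) xs) ⟩
  Σ< K (λ i → conj (x ∷ []) (suc i) + conj xs (suc i))            ≡⟨ Σ<-+ K _ _ ⟩
  Σ< K (λ i → conj (x ∷ []) (suc i)) + Σ< K (λ i → conj xs (suc i)) ≡⟨ cong₂ _+_ (Σ<-conj-singleton x x≤K) (sym (sum≡Σ<conj K ps)) ⟩
  x + sum xs                                                      ∎)
  where open ≡-Reasoning

-- Durfee symbols

≤-durfeeFrom : ∀ s xs i → suc (s + i) ≤ at xs i → suc (s + i) ≤ durfeeFrom s xs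
≤-durfeeFrom s (x ∷ xs) i le with suc s ≤? x
≤-durfeeFrom s (x ∷ xs) zero    le | yes _   rewrite +-identityʳ s = m≤m⊔n (suc s) (durfeeFrom (suc s) xs)
≤-durfeeFrom s (x ∷ xs) zero    le | no s≮x  rewrite +-identityʳ s = contradiction le s≮x
≤-durfeeFrom s (x ∷ xs) (suc i) le | yes _   rewrite +-suc s i = ≤-trans (≤-durfeeFrom (suc s) xs i le) (m≤n⊔m (suc s) (durfeeFrom (suc s) xs))
≤-durfeeFrom s (x ∷ xs) (suc i) le | no _    rewrite +-suc s i = ≤-durfeeFrom (suc s) xs i le

durfeeFrom-≤ : ∀ s xs K → (∀ i → suc (s + i) ≤ at xs i → suc (s + i) ≤ K) → durfeeFrom s xs ≤ K
durfeeFrom-≤ s []       K h = z≤n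
durfeeFrom-≤ s (x ∷ xs) K h with suc s ≤? x
                               | durfeeFrom-≤ (suc s) xs K (λ i → subst (λ t → suc t ≤ at xs i → suc t ≤ K) (+-suc s i) (h (suc i)))
... | yes s<x | rest = ⊔-lub (subst (λ t → suc t ≤ x → suc t ≤ K) (+-identityʳ s) (h 0) s<x) rest
... | no _    | rest = rest

at-durfee-≤ : ∀ xs → at xs (durfee xs) ≤ durfee xs
at-durfee-≤ xs with suc (durfee xs) ≤? at xs (durfee xs)
... | yes j<x = contradiction (≤-durfeeFrom 0 xs (durfee xs) j<x) (n≮n (durfee xs))
... | no j≮x  = ≤-pred (≰⇒> j≮x)

durfee-≡ : ∀ {xs j} → Sorted xs → j ≤ at xs (j ∸ 1) → at xs j ≤ j → 1 ≤ j → durfee xs ≡ j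
durfee-≡ {xs} {suc j} s j≤x x≤j _ = ≤-antisym (durfeeFrom-≤ 0 xs (suc j) inSquare) (≤-durfeeFrom 0 xs j j≤x)
  where
  inSquare : ∀ i → suc i ≤ at xs i → suc i ≤ suc j
  inSquare i i<x with i ≤? j
  ... | yes i≤j = s≤s i≤j
  ... | no i≰j  = contradiction (≤-trans i<x (≤-trans (at-antitone s (≰⇒> i≰j)) (≤-trans x≤j (≰⇒> i≰j)))) (n≮n i)

length-durfeeα : ∀ μ → length (durfeeα μ) ≡ at μ 0 ∸ durfee μ
length-durfeeα μ = trans (length-map _ (upTo (at μ 0 ∸ durfee μ))) (length-upTo _)

at-durfeeα : ∀ μ {i} → i < at μ 0 ∸ durfee μ → at (durfeeα μ) i ≡ conj μ (durfee μ + suc i)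
at-durfeeα μ i<ℓ = trans (cong (λ α → at α _) (map-upTo _ (at μ 0 ∸ durfee μ))) (at-applyUpTo _ _ i<ℓ)

smallest≡nothing⇒[] : ∀ xs → smallest xs ≡ nothing → xs ≡ []
smallest≡nothing⇒[] [] _ = refl
smallest≡nothing⇒[] (x ∷ xs) e with smallest xs
smallest≡nothing⇒[] (x ∷ xs) () | nothing
smallest≡nothing⇒[] (x ∷ xs) () | just _

smallest≡just⇒All≥ : ∀ xs {m} → smallest xs ≡ just m → All (m ≤_) xs
smallest≡just⇒All≥ (x ∷ xs) e with smallest xs in e′
smallest≡just⇒All≥ (x ∷ xs) refl | nothing with refl ← smallest≡nothing⇒[] xs e′ = ≤-refl ∷ []
smallest≡just⇒All≥ (x ∷ xs) refl | just m′ = m⊓n≤m x m′ ∷ All.map (≤-trans (m⊓n≤n x m′)) (smallest≡just⇒All≥ xs e′)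

smallest≡just⇒∈ : ∀ xs {m} → smallest xs ≡ just m → m ∈ xs
smallest≡just⇒∈ (x ∷ xs) e with smallest xs in e′
smallest≡just⇒∈ (x ∷ xs) refl | nothing = here refl
smallest≡just⇒∈ (x ∷ xs) refl | just m′ with ⊓-sel x m′
... | inj₁ x⊓m′≡x  = here x⊓m′≡x
... | inj₂ x⊓m′≡m′ = there (subst (_∈ xs) (sym x⊓m′≡m′) (smallest≡just⇒∈ xs e′))

SmallestGe⇒All≥ : ∀ xs {k} → SmallestGe xs k → All (k ≤_) xs
SmallestGe⇒All≥ xs sg with smallest xs in e
SmallestGe⇒All≥ xs sg | nothing with refl ← smallest≡nothing⇒[] xs e = []
SmallestGe⇒All≥ xs sg | just m = All.map (≤-trans sg) (smallest≡just⇒All≥ xs e)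

-- The entry i − λ_{i+1} of the rank-set is negative for i < j and positive for i > j.
0∈rankSet⇒at≡ : ∀ {μ j} → Sorted μ → suc j ≤ at μ (j ∸ 1) → at μ j ≤ j → InRankSet (ℤ.+ 0) μ → at μ j ≡ j
0∈rankSet⇒at≡ {μ} {j} _ j<λj _ (inj₂ (ℤ.+≤+ ℓ≤0)) =
  contradiction (≤-trans (at>0⇒<length μ (j ∸ 1) (≤-trans z<s j<λj)) ℓ≤0) n≮0
0∈rankSet⇒at≡ {μ} {j} s j<λj λj₊₁≤j (inj₁ (i , _ , 0≡i-λi))
  with ℤₚ.+-injective (ℤₚ.i-j≡0⇒i≡j (ℤ.+ i) (ℤ.+ at μ i) (sym 0≡i-λi)) | <-cmp i j
... | i≡λi | tri< i<j _ _ = contradiction (≤-trans (m<n⇒m<1+n i<j) (≤-trans j<λj (at-antitone s (∸-monoˡ-≤ 1 i<j)))) (<-irrefl i≡λi)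
... | i≡λi | tri≈ _ refl _ = sym i≡λi
... | i≡λi | tri> _ _ j<i = contradiction (≤-<-trans (≤-trans (at-antitone s (<⇒≤ j<i)) λj₊₁≤j) j<i) (<-irrefl (sym i≡λi))

InP8-intro : ∀ {n ν j} → IsPartition n ν → at ν 0 ≡ length ν → durfee ν ≡ j → 1 ≤ j → 2 ≤ at ν 0 ∸ j →
             conj ν (j + 1) ≡ j ∸ 1 → conj ν (j + 2) ≡ j ∸ 1 → at ν j ≡ j → ¬ 2 ∈ drop j ν → InP8 n ν
InP8-intro {ν = ν} {j} partition ν₁≡ℓ refl 1≤j 2≤ℓα γ₁ γ₂ ν₍j+1₎≡j no-2 =
  (partition , rank≥0) , 1≤j , ℓα≡ℓβ , trans (at-durfeeα ν (≤-trans (s≤s z≤n) 2≤ℓα)) γ₁ , trans (at-durfeeα ν 2≤ℓα) γ₂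
  , trans (at-drop j ν 0) (trans (cong (at ν) (+-identityʳ j)) ν₍j+1₎≡j) , no-2
  where
  rank≥0 : ℤ.+ 0 ℤ.≤ rank ν
  rank≥0 = ℤₚ.≤-reflexive (sym (trans (cong (λ t → ℤ.+ t ℤ.- ℤ.+ length ν) ν₁≡ℓ) (ℤₚ.+-inverseʳ (ℤ.+ length ν))))
  ℓα≡ℓβ : length (durfeeα ν) ≡ length (durfeeβ ν)
  ℓα≡ℓβ = trans (length-durfeeα ν) (trans (cong (_∸ j) ν₁≡ℓ) (sym (length-drop j ν)))

module Durfee (μ : List ℕ) where
  j = durfee μ
  w = at μ (j ∸ 1)
  h = at μ 0
  β = durfeeβ μ
  m = length β

record Q̄₅Shape (n : ℕ) (μ : List ℕ) : Set where
  open Durfee μ public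
  field
    sorted   : Sorted μ
    positive : All (0 <_) μ
    sum≡n    : sum μ ≡ n
    3≤j      : 3 ≤ j
    j+2≤w    : j + 2 ≤ w
    β₁≡j     : at β 0 ≡ j
    β₂<j     : at β 1 < j
    β≥2      : All (2 ≤_) β
    β′₃<m    : conj β 3 < m
    h∸j<m    : h ∸ j < m
    α≥2      : ∀ {k} → j < k → k ≤ h → 2 ≤ conj μ k

InQbar5⇒Q̄₅Shape : ∀ {n μ} → InQbar5 n μ → Q̄₅Shape n μ
InQbar5⇒Q̄₅Shape {n} {μ} (((sorted , positive , sum≡n) , 0∈ranks) , 1≤j , ℓα<ℓβ , _ , α₂≡j , α≥2 , β₂<β₁ , sβ≡2) = record
  { sorted = sorted ; positive = positive ; sum≡n = sum≡n ; 3≤j = 3≤j ; j+2≤w = j+2≤w ; β₁≡j = β₁≡j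
  ; β₂<j = subst (at β 1 <_) β₁≡j β₂<β₁ ; β≥2 = β≥2 ; β′₃<m = conj<length ≤-refl (smallest≡just⇒∈ β sβ≡2)
  ; h∸j<m = h∸j<m ; α≥2 = column≥2 }
  where
  open Durfee μ
  2≤h∸j : 2 ≤ h ∸ j
  2≤h∸j = subst (2 ≤_) (length-durfeeα μ) (at>0⇒<length (durfeeα μ) 1 (subst (0 <_) (sym α₂≡j) 1≤j))
  j+2≤w : j + 2 ≤ w
  j+2≤w = <conj⇒≤at sorted (subst (j ∸ 1 <_) (trans (sym α₂≡j) (at-durfeeα μ {1} 2≤h∸j)) (∸-monoʳ-< z<s 1≤j))
  β₁≡j : at β 0 ≡ j
  β₁≡j = trans (at-drop j μ 0) (trans (cong (at μ) (+-identityʳ j))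
           (0∈rankSet⇒at≡ sorted (≤-trans (m<m+n j z<s) j+2≤w) (at-durfee-≤ μ) 0∈ranks))
  h∸j<m : h ∸ j < m
  h∸j<m = subst (_< m) (length-durfeeα μ) ℓα<ℓβ
  β≥2 : All (2 ≤_) β
  β≥2 = smallest≡just⇒All≥ β sβ≡2
  3≤j : 3 ≤ j
  3≤j = ≤-trans (s≤s (All⇒at 1 β≥2 (<-≤-trans 2≤h∸j (<⇒≤ h∸j<m)))) (subst (at β 1 <_) β₁≡j β₂<β₁)
  column≥2 : ∀ {k} → j < k → k ≤ h → 2 ≤ conj μ k
  column≥2 {k} j<k k≤h = subst (λ c → 2 ≤ conj μ c) j+suc-i≡k (subst (2 ≤_) (at-durfeeα μ i<h∸j)
    (All⇒at i (SmallestGe⇒All≥ (durfeeα μ) α≥2) (subst (i <_) (sym (length-durfeeα μ)) i<h∸j)))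
    where
    i = k ∸ suc j
    j+suc-i≡k : j + suc i ≡ k
    j+suc-i≡k = trans (+-suc j i) (m+[n∸m]≡n j<k)
    i<h∸j : i < h ∸ j
    i<h∸j = m+n≤o⇒m≤o∸n (suc i) (subst (_≤ h) (trans (sym j+suc-i≡k) (+-comm j (suc i))) k≤h)

module Columns {n μ} (S : Q̄₅Shape n μ) where
  open Q̄₅Shape S public

  1≤j : 1 ≤ j
  1≤j = ≤-trans (s≤s z≤n) 3≤j

  j≤w : j ≤ w
  j≤w = ≤-trans (m≤m+n j 2) j+2≤w

  1≤w : 1 ≤ w
  1≤w = ≤-trans 1≤j j≤w

  w≤h : w ≤ h
  w≤h = at-antitone sorted z≤n

  3≤m : 3 ≤ m
  3≤m = ≤-trans (s≤s (subst (_≤ h ∸ j) (m+n∸m≡n j 2) (∸-monoˡ-≤ j (≤-trans j+2≤w w≤h)))) h∸j<m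

  1≤m : 1 ≤ m
  1≤m = ≤-trans (s≤s z≤n) 3≤m

  sortedβ : Sorted β
  sortedβ = sorted-drop j sorted

  β≤j : All (_≤ j) β
  β≤j = subst (λ b → All (_≤ b) β) β₁≡j (≤-head sortedβ)

  conjβ-≤2 : ∀ {k} → k ≤ 2 → conj β k ≡ m
  conjβ-≤2 k≤2 = conj-all (All.map (≤-trans k≤2) β≥2)

  conjβ-j : conj β j ≡ 1
  conjβ-j = conj-peak β sortedβ β₁≡j β₂<j

  1≤conjβ : ∀ {k} → k ≤ j → 1 ≤ conj β k
  1≤conjβ k≤j = subst (_≤ conj β _) conjβ-j (conj-antitone β k≤j)

  conjβ->j : ∀ {k} → j < k → conj β k ≡ 0
  conjβ->j j<k = conj-none (All.map (λ b≤j → ≤-<-trans b≤j j<k) β≤j)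

  top : List ℕ
  top = take j μ

  length-top : length top ≡ j
  length-top = trans (length-take j μ) (m≤n⇒m⊓n≡m j≤ℓ)
    where
    j≤ℓ : j ≤ length μ
    j≤ℓ = subst (_≤ length μ) (m+[n∸m]≡n 1≤j) (at>0⇒<length μ (j ∸ 1) (≤-trans z<s 1≤w))

  top≥w : All (w ≤_) top
  top≥w = at⇒All top λ i i<ℓ → let i<j = subst (i <_) length-top i<ℓ in
    subst (w ≤_) (sym (at-take j μ i<j)) (at-antitone sorted (∸-monoˡ-≤ 1 i<j))

  conj-top-β : ∀ k → conj μ k ≡ conj top k + conj β k
  conj-top-β k = trans (cong (λ ν → conj ν k) (sym (take++drop≡id j μ))) (conj-++ k top β)

  conj-top : ∀ {k} → k ≤ w → conj top k ≡ j
  conj-top k≤w = trans (conj-all (All.map (≤-trans k≤w) top≥w)) length-top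

  conj-left : ∀ {k} → k ≤ j → conj μ k ≡ j + conj β k
  conj-left {k} k≤j = trans (conj-top-β k) (cong (_+ conj β k) (conj-top (≤-trans k≤j j≤w)))

  conj-middle : ∀ {k} → j < k → k ≤ w → conj μ k ≡ j
  conj-middle j<k k≤w = trans (conj-top-β _) (trans (cong₂ _+_ (conj-top k≤w) (conjβ->j j<k)) (+-identityʳ j))

  conj-right : ∀ {k} → w < k → conj μ k ≤ j ∸ 1
  conj-right {k} w<k with j ∸ 1 <? conj μ k
  ... | yes j∸1<c = contradiction (<conj⇒≤at sorted j∸1<c) (<⇒≱ w<k)
  ... | no j∸1≮c  = ≮⇒≥ j∸1≮c

  conj-outside : ∀ {k} → h < k → conj μ k ≡ 0
  conj-outside h<k = conj-none (All.map (λ x≤h → ≤-<-trans x≤h h<k) (≤-head sorted))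

  -- d columns of length j right of the square, then q shorter ones
  d q : ℕ
  d = w ∸ j
  q = h ∸ w

  w≡j+d : w ≡ j + d
  w≡j+d = sym (m+[n∸m]≡n j≤w)

  2≤d : 2 ≤ d
  2≤d = subst (_≤ d) (m+n∸m≡n j 2) (∸-monoˡ-≤ j j+2≤w)

  h≡j+[d+q] : h ≡ j + (d + q)
  h≡j+[d+q] = trans (sym (m+[n∸m]≡n w≤h)) (trans (cong (_+ q) w≡j+d) (+-assoc j d q))

  Σβ′ Σtail : ℕ
  Σβ′ = Σ< (j ∸ 3) (λ i → conj β (4 + i))
  Σtail = Σ< q (λ i → conj μ (w + suc i))

  sum-β : sum β ≡ m + (m + (conj β 3 + 0)) + Σβ′
  sum-β = begin
    sum β                                        ≡⟨ sum≡Σ<conj j β≤j ⟩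
    Σ< j (λ i → conj β (suc i))                  ≡⟨ cong (λ t → Σ< t (λ i → conj β (suc i))) (sym (m+[n∸m]≡n 3≤j)) ⟩
    Σ< (3 + (j ∸ 3)) (λ i → conj β (suc i))      ≡⟨ Σ<-split 3 (j ∸ 3) (λ i → conj β (suc i)) ⟩
    conj β 1 + (conj β 2 + (conj β 3 + 0)) + Σβ′
      ≡⟨ cong₂ (λ a b → a + (b + (conj β 3 + 0)) + Σβ′) (conjβ-≤2 (s≤s z≤n)) (conjβ-≤2 ≤-refl) ⟩
    m + (m + (conj β 3 + 0)) + Σβ′               ∎
    where open ≡-Reasoning

  sum-μ : sum μ ≡ j * j + sum β + (d * j + Σtail)
  sum-μ = begin
    sum μ                                                             ≡⟨ sum≡Σ<conj h (≤-head sorted) ⟩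
    Σ< h col                                                          ≡⟨ cong (λ t → Σ< t col) h≡j+[d+q] ⟩
    Σ< (j + (d + q)) col                                              ≡⟨ Σ<-split j (d + q) col ⟩
    Σ< j col + Σ< (d + q) (λ i → col (j + i))                         ≡⟨ cong (Σ< j col +_) (Σ<-split d q (λ i → col (j + i))) ⟩
    Σ< j col + (Σ< d (λ i → col (j + i)) + Σ< q (λ i → col (j + (d + i)))) ≡⟨ cong₂ _+_ square-and-β (cong₂ _+_ middle tail) ⟩
    j * j + sum β + (d * j + Σtail)                                   ∎
    where
    open ≡-Reasoning
    col : ℕ → ℕ
    col i = conj μ (suc i)
    square-and-β : Σ< j col ≡ j * j + sum β
    square-and-β = trans (Σ<-cong j conj-left) (trans (Σ<-+ j (λ _ → j) (λ i → conj β (suc i)))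
                     (cong₂ _+_ (Σ<-const j j) (sym (sum≡Σ<conj j β≤j))))
    middle : Σ< d (λ i → col (j + i)) ≡ d * j
    middle = trans (Σ<-cong d (λ {i} i<d → conj-middle (s≤s (m≤m+n j i)) (subst (j + i <_) (sym w≡j+d) (+-monoʳ-< j i<d))))
               (Σ<-const d j)
    tail : Σ< q (λ i → col (j + (d + i))) ≡ Σtail
    tail = Σ<-cong q (λ {i} _ → cong (conj μ)
             (trans (cong suc (trans (sym (+-assoc j d i)) (cong (_+ i) (sym w≡j+d)))) (sym (+-suc w i))))

-- The injection

-- All truncated subtractions vanish once j and w are written as 3 + J₃ and j + d.
rowSums : ∀ {j w m c Σβ′ Σtail} J₃ d q r → j ≡ 3 + J₃ → w ≡ j + d → r + q + 2 ≡ m + d →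
  (w + m ∸ 1) + ((w + c) + ((j ∸ 3) * (w ∸ 1) + Σβ′)) + (j + (j + ((q * 1 + Σtail) + r * 1)))
  ≡ j * j + (m + (m + (c + 0)) + Σβ′) + (d * j + Σtail)
rowSums {m = m} {c} {Σβ′} {Σtail} J₃ d q r refl refl r+q+2≡m+d =
  +-cancelʳ-≡ (m + d) _ _ (trans (identity J₃ d m c Σβ′ Σtail q r)
    (cong (λ t → (3 + J₃) * (3 + J₃) + (m + (m + (c + 0)) + Σβ′) + (d * (3 + J₃) + Σtail) + t) r+q+2≡m+d))
  where
  identity : ∀ J₃ d m c Σβ′ Σtail q r →
    (2 + J₃ + d + m) + ((3 + J₃ + d + c) + (J₃ * (2 + J₃ + d) + Σβ′)) + (3 + J₃ + (3 + J₃ + ((q * 1 + Σtail) + r * 1))) + (m + d)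
    ≡ (3 + J₃) * (3 + J₃) + (m + (m + (c + 0)) + Σβ′) + (d * (3 + J₃) + Σtail) + (r + q + 2)
  identity = solve-∀

rowCount : ∀ {j w m} J₁ d q r → j ≡ suc J₁ → w ≡ j + d → r + q + 2 ≡ m + d →
  w + m ∸ 1 ≡ (j ∸ 1) + suc (suc (q + r))
rowCount {m = m} J₁ d q r refl refl r+q+2≡m+d =
  +-cancelʳ-≡ (m + d) _ _ (trans (cong (J₁ + d + m +_) (sym r+q+2≡m+d)) (identity J₁ d m q r))
  where
  identity : ∀ J₁ d m q r → J₁ + d + m + (r + q + 2) ≡ J₁ + suc (suc (q + r)) + (m + d)
  identity = solve-∀

module _ (μ : List ℕ) where
  open Durfee μ

  upperRows : List ℕ
  upperRows = (w + m ∸ 1) ∷ (w + conj β 3) ∷ applyUpTo (λ i → w ∸ 1 + conj β (4 + i)) (j ∸ 3)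

  middleRows : List ℕ
  middleRows = applyUpTo (λ i → suc (conj μ (w + suc i))) (h ∸ w)

  onesCount : ℕ
  onesCount = m + (w ∸ j) ∸ 2 ∸ (h ∸ w)

  lowerRows : List ℕ
  lowerRows = j ∷ middleRows ++ replicate onesCount 1

  image : List ℕ
  image = upperRows ++ j ∷ lowerRows

module Image {n μ} (S : Q̄₅Shape n μ) where
  open Columns S public

  U M L ν : List ℕ
  U = upperRows μ
  M = middleRows μ
  L = lowerRows μ
  ν = image μ

  r : ℕ
  r = onesCount μ

  upper : ℕ → ℕ
  upper i = w ∸ 1 + conj β (4 + i)

  length-U : length U ≡ j ∸ 1
  length-U = trans (cong (2 +_) (length-applyUpTo upper (j ∸ 3))) (sym (+-∸-assoc 2 3≤j))

  length-M : length M ≡ q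
  length-M = length-applyUpTo _ q

  w+m∸1≡w+[m∸1] : w + m ∸ 1 ≡ w + (m ∸ 1)
  w+m∸1≡w+[m∸1] = +-∸-assoc w 1≤m

  U≥w : All (w ≤_) U
  U≥w = subst (w ≤_) (sym w+m∸1≡w+[m∸1]) (m≤m+n w _) ∷ m≤m+n w _ ∷ applyUpTo⁺₁ upper (j ∸ 3) w≤upper
    where
    w≤upper : ∀ {i} → i < j ∸ 3 → w ≤ upper i
    w≤upper i<j∸3 = subst (_≤ upper _) (m∸n+n≡m 1≤w)
      (+-monoʳ-≤ (w ∸ 1) (1≤conjβ (subst (_ ≤_) (m+[n∸m]≡n 3≤j) (+-monoʳ-≤ 3 i<j∸3))))

  sorted-U : Sorted U
  sorted-U = sorted-∷ (U₂≤U₁ ∷ All.map (λ x≤U₂ → ≤-trans x≤U₂ U₂≤U₁) upper≤U₂) (sorted-∷ upper≤U₂ sorted-upper)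
    where
    U₂≤U₁ : w + conj β 3 ≤ w + m ∸ 1
    U₂≤U₁ = subst (w + conj β 3 ≤_) (sym w+m∸1≡w+[m∸1]) (+-monoʳ-≤ w (<⇒≤pred β′₃<m))
    upper≤U₂ : All (_≤ w + conj β 3) (applyUpTo upper (j ∸ 3))
    upper≤U₂ = applyUpTo⁺₂ upper (j ∸ 3) (λ i → +-mono-≤ (m∸n≤m w 1) (conj-antitone β (s≤s (s≤s (s≤s z≤n)))))
    sorted-upper : Sorted (applyUpTo upper (j ∸ 3))
    sorted-upper = Linked-applyUpTo⁺ upper (j ∸ 3) (λ i → +-monoʳ-≤ (w ∸ 1) (conj-antitone β (n≤1+n (4 + i))))

  middle-bounds : ∀ {i} → i < q → 3 ≤ suc (conj μ (w + suc i)) × suc (conj μ (w + suc i)) ≤ j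
  middle-bounds {i} i<q =
    s≤s (α≥2 (≤-<-trans j≤w (m<m+n w z<s)) (subst (w + suc i ≤_) (m+[n∸m]≡n w≤h) (+-monoʳ-≤ w i<q))) ,
    subst (suc (conj μ (w + suc i)) ≤_) (m+[n∸m]≡n 1≤j) (s≤s (conj-right (m<m+n w z<s)))

  M≥3 : All (3 ≤_) M
  M≥3 = applyUpTo⁺₁ _ q (proj₁ ∘ middle-bounds)

  M++ones≤j : All (_≤ j) (M ++ replicate r 1)
  M++ones≤j = ++⁺ (applyUpTo⁺₁ _ q (proj₂ ∘ middle-bounds)) (replicate⁺ r 1≤j)

  sorted-jL : Sorted (j ∷ L)
  sorted-jL = sorted-∷ (≤-refl ∷ M++ones≤j) (sorted-∷ M++ones≤j sorted-M++ones)
    where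
    sorted-M : Sorted M
    sorted-M = Linked-applyUpTo⁺ _ q (λ i → s≤s (conj-antitone μ (+-monoʳ-≤ w (n≤1+n (suc i)))))
    sorted-M++ones : Sorted (M ++ replicate r 1)
    sorted-M++ones = sorted-++ 1 sorted-M (sorted-replicate r 1) (All.map (≤-trans (s≤s z≤n)) M≥3) (replicate⁺ r ≤-refl)

  sorted-ν : Sorted ν
  sorted-ν = sorted-++ j sorted-U sorted-jL (All.map (≤-trans j≤w) U≥w) (≤-refl ∷ ≤-refl ∷ M++ones≤j)

  positive-ν : All (0 <_) ν
  positive-ν = ++⁺ (All.map (≤-trans 1≤w) U≥w) (1≤j ∷ 1≤j ∷ ++⁺ (All.map (≤-trans (s≤s z≤n)) M≥3) (replicate⁺ r ≤-refl))

  r+q+2≡m+d : r + q + 2 ≡ m + d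
  r+q+2≡m+d = trans (cong (_+ 2) (m∸n+n≡m q≤m+d∸2)) (m∸n+n≡m (≤-trans (m≤n+m 2 q) q+2≤m+d))
    where
    q≤m : q ≤ m
    q≤m = ≤-trans (m≤n+m q d) (<⇒≤ (subst (_< m) (trans (cong (_∸ j) h≡j+[d+q]) (m+n∸m≡n j (d + q))) h∸j<m))
    q+2≤m+d : q + 2 ≤ m + d
    q+2≤m+d = +-mono-≤ q≤m 2≤d
    q≤m+d∸2 : q ≤ m + d ∸ 2
    q≤m+d∸2 = m+n≤o⇒m≤o∸n q q+2≤m+d

  sum-ν : sum ν ≡ n
  sum-ν = begin
    sum ν                                                       ≡⟨ sum-++ U (j ∷ L) ⟩
    sum U + (j + (j + sum (M ++ replicate r 1)))
                                                                ≡⟨ cong₂ (λ a b → (w + m ∸ 1) + ((w + conj β 3) + a) + (j + (j + b))) sum-upper sum-M++ones ⟩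
    (w + m ∸ 1) + ((w + conj β 3) + ((j ∸ 3) * (w ∸ 1) + Σβ′)) + (j + (j + ((q * 1 + Σtail) + r * 1)))
                                                                ≡⟨ rowSums (j ∸ 3) d q r (sym (m+[n∸m]≡n 3≤j)) w≡j+d r+q+2≡m+d ⟩
    j * j + (m + (m + (conj β 3 + 0)) + Σβ′) + (d * j + Σtail)  ≡⟨ cong (λ b → j * j + b + (d * j + Σtail)) (sym sum-β) ⟩
    j * j + sum β + (d * j + Σtail)                             ≡⟨ sym sum-μ ⟩
    sum μ                                                       ≡⟨ sum≡n ⟩
    n                                                           ∎
    where
    open ≡-Reasoning
    sum-upper : Σ< (j ∸ 3) upper ≡ (j ∸ 3) * (w ∸ 1) + Σβ′
    sum-upper = trans (Σ<-+ (j ∸ 3) (λ _ → w ∸ 1) (λ i → conj β (4 + i))) (cong (_+ Σβ′) (Σ<-const (j ∸ 3) (w ∸ 1)))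
    sum-M++ones : sum (M ++ replicate r 1) ≡ (q * 1 + Σtail) + r * 1
    sum-M++ones = trans (sum-++ M (replicate r 1))
      (cong₂ _+_ (trans (Σ<-+ q (λ _ → 1) (λ i → conj μ (w + suc i))) (cong (_+ Σtail) (Σ<-const q 1))) (sum-replicate r 1))

  ν₁≡ℓ : at ν 0 ≡ length ν
  ν₁≡ℓ = trans (rowCount (j ∸ 1) d q r (sym (m+[n∸m]≡n 1≤j)) w≡j+d r+q+2≡m+d)
    (sym (trans (length-++ U) (cong₂ (λ a b → a + suc (suc b)) length-U (trans (length-++ M) (cong₂ _+_ length-M (length-replicate r))))))

  length-U+1≡j : length U + 1 ≡ j
  length-U+1≡j = trans (cong (_+ 1) length-U) (trans (+-comm (j ∸ 1) 1) (m+[n∸m]≡n 1≤j))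

  ν₍j₎≡j : at ν (j ∸ 1) ≡ j
  ν₍j₎≡j = subst (λ t → at ν t ≡ j) (trans (+-identityʳ _) length-U) (at-++ʳ U (j ∷ L) 0)

  ν₍j+1₎≡j : at ν j ≡ j
  ν₍j+1₎≡j = subst (λ t → at ν t ≡ j) length-U+1≡j (at-++ʳ U (j ∷ L) 1)

  durfee-ν : durfee ν ≡ j
  durfee-ν = durfee-≡ sorted-ν (≤-reflexive (sym ν₍j₎≡j)) (≤-reflexive ν₍j+1₎≡j) 1≤j

  drop-ν : drop j ν ≡ L
  drop-ν = begin
    drop j ν                      ≡⟨ cong (λ t → drop t ν) (sym length-U+1≡j) ⟩
    drop (length U + 1) ν         ≡⟨ sym (drop-drop (length U) 1 ν) ⟩
    drop 1 (drop (length U) ν)    ≡⟨ cong (drop 1) (drop-++ U (j ∷ L)) ⟩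
    L                             ∎
    where open ≡-Reasoning

  conj-ν : ∀ {k} → j < k → k ≤ w → conj ν k ≡ j ∸ 1
  conj-ν {k} j<k k≤w = trans (conj-++ k U (j ∷ L))
    (trans (cong₂ _+_ (conj-all (All.map (≤-trans k≤w) U≥w)) (conj-none (All.map (λ x≤j → ≤-<-trans x≤j j<k) (≤-refl ∷ ≤-refl ∷ M++ones≤j))))
      (trans (+-identityʳ _) length-U))

  2∉L : ¬ 2 ∈ L
  2∉L 2∈L = All.lookup L≢2 2∈L refl
    where
    ≥3⇒≢2 : ∀ {y} → 3 ≤ y → ¬ 2 ≡ y
    ≥3⇒≢2 3≤y 2≡y = <-irrefl 2≡y 3≤y
    L≢2 : All (λ y → ¬ 2 ≡ y) L
    L≢2 = ≥3⇒≢2 3≤j ∷ ++⁺ (All.map ≥3⇒≢2 M≥3) (replicate⁺ r (λ ()))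

  image∈P8 : InP8 n ν
  image∈P8 = InP8-intro (sorted-ν , positive-ν , sum-ν) ν₁≡ℓ durfee-ν 1≤j 2≤ν₁∸j
    (conj-ν (m<m+n j z<s) (≤-trans (+-monoʳ-≤ j (s≤s z≤n)) j+2≤w)) (conj-ν (m<m+n j z<s) j+2≤w)
    ν₍j+1₎≡j (subst (λ δ → ¬ 2 ∈ δ) (sym drop-ν) 2∉L)
    where
    2≤ν₁∸j : 2 ≤ at ν 0 ∸ j
    2≤ν₁∸j = m+n≤o⇒m≤o∸n 2 (≤-trans (≤-reflexive (+-comm 2 j)) (≤-trans j+2≤w (subst (w ≤_) (sym w+m∸1≡w+[m∸1]) (m≤m+n w _))))

  ν₂≡w+1 : j ≡ 3 → at ν 1 ≡ w + 1
  ν₂≡w+1 j≡3 = cong (w +_) (trans (cong (conj β) (sym j≡3)) conjβ-j)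

  at-ν-upper : ∀ {i} → i < j ∸ 3 → at ν (2 + i) ≡ upper i
  at-ν-upper i<j∸3 = trans (at-++ˡ (applyUpTo upper (j ∸ 3)) (j ∷ L) (subst (_ <_) (sym (length-applyUpTo upper (j ∸ 3))) i<j∸3))
                           (at-applyUpTo upper (j ∸ 3) i<j∸3)

  ν₍j-1₎≡w : 4 ≤ j → at ν (2 + (j ∸ 4)) ≡ w
  ν₍j-1₎≡w 4≤j = begin
    at ν (2 + (j ∸ 4))          ≡⟨ at-ν-upper (∸-monoʳ-< ≤-refl 4≤j) ⟩
    w ∸ 1 + conj β (4 + (j ∸ 4)) ≡⟨ cong (λ k → w ∸ 1 + conj β k) (m+[n∸m]≡n 4≤j) ⟩
    w ∸ 1 + conj β j            ≡⟨ cong (w ∸ 1 +_) conjβ-j ⟩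
    w ∸ 1 + 1                   ≡⟨ m∸n+n≡m 1≤w ⟩
    w                           ∎
    where open ≡-Reasoning

module Injective {n μ μ′} (S : Q̄₅Shape n μ) (S′ : Q̄₅Shape n μ′) (same-image : image μ ≡ image μ′) where
  open Image S
  module I′ = Image S′

  same-row : ∀ i → at ν i ≡ at I′.ν i
  same-row i = cong (λ ξ → at ξ i) same-image

  j≡j′ : j ≡ I′.j
  j≡j′ = trans (sym durfee-ν) (trans (cong durfee same-image) I′.durfee-ν)

  -- Row j − 1 of the image is w + β'₃ = w + 1 when j = 3 and w − 1 + β'_j = w when j ≥ 4.
  w≡w′ : w ≡ I′.w
  w≡w′ with j ≟ 3
  ... | yes j≡3 = +-cancelʳ-≡ 1 _ _ (trans (sym (ν₂≡w+1 j≡3)) (trans (same-row 1) (I′.ν₂≡w+1 (trans (sym j≡j′) j≡3))))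
  ... | no j≢3  = trans (sym (ν₍j-1₎≡w 4≤j)) (trans (same-row (2 + (j ∸ 4))) (trans (cong (λ t → at I′.ν (2 + (t ∸ 4))) j≡j′)
                    (I′.ν₍j-1₎≡w (subst (4 ≤_) j≡j′ 4≤j))))
    where
    4≤j : 4 ≤ j
    4≤j = ≤∧≢⇒< 3≤j (j≢3 ∘ sym)

  m≡m′ : m ≡ I′.m
  m≡m′ = trans (sym (m+[n∸m]≡n 1≤m)) (trans (cong suc m∸1≡m′∸1) (m+[n∸m]≡n I′.1≤m))
    where
    m∸1≡m′∸1 : m ∸ 1 ≡ I′.m ∸ 1
    m∸1≡m′∸1 = +-cancelˡ-≡ w _ _ (trans (sym w+m∸1≡w+[m∸1]) (trans (same-row 0)
                 (trans I′.w+m∸1≡w+[m∸1] (cong (_+ (I′.m ∸ 1)) (sym w≡w′)))))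

  β′₃≡ : conj β 3 ≡ conj I′.β 3
  β′₃≡ = +-cancelˡ-≡ w _ _ (trans (same-row 1) (cong (_+ conj I′.β 3) (sym w≡w′)))

  β′-upper≡ : ∀ {i} → i < j ∸ 3 → conj β (4 + i) ≡ conj I′.β (4 + i)
  β′-upper≡ {i} i<j∸3 = +-cancelˡ-≡ (w ∸ 1) _ _ (trans (sym (at-ν-upper i<j∸3)) (trans (same-row (2 + i))
    (trans (I′.at-ν-upper (subst (λ t → i < t ∸ 3) j≡j′ i<j∸3)) (cong (λ t → t ∸ 1 + conj I′.β (4 + i)) (sym w≡w′)))))

  M≡M′ : M ≡ I′.M
  M≡M′ = ++-ones-injective r I′.r (All.map (≤-trans (n≤1+n 2)) M≥3) (All.map (≤-trans (n≤1+n 2)) I′.M≥3) (begin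
    M ++ replicate r 1        ≡⟨ cong (drop 1) (sym drop-ν) ⟩
    drop 1 (drop j ν)         ≡⟨ cong₂ (λ t ξ → drop 1 (drop t ξ)) j≡j′ same-image ⟩
    drop 1 (drop I′.j I′.ν)   ≡⟨ cong (drop 1) I′.drop-ν ⟩
    I′.M ++ replicate I′.r 1  ∎)
    where open ≡-Reasoning

  q≡q′ : q ≡ I′.q
  q≡q′ = trans (sym length-M) (trans (cong length M≡M′) I′.length-M)

  h≡h′ : h ≡ I′.h
  h≡h′ = trans (sym (m+[n∸m]≡n w≤h)) (trans (cong₂ _+_ w≡w′ q≡q′) (m+[n∸m]≡n I′.w≤h))

  tail≡ : ∀ {i} → i < q → conj μ (w + suc i) ≡ conj μ′ (I′.w + suc i)
  tail≡ {i} i<q = suc-injective (trans (sym (at-applyUpTo _ q i<q))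
    (trans (cong (λ ξ → at ξ i) M≡M′) (at-applyUpTo _ I′.q (subst (i <_) q≡q′ i<q))))

  conjβ≡ : ∀ {k} → suc k ≤ j → conj β (suc k) ≡ conj I′.β (suc k)
  conjβ≡ {0}             _   = trans (conjβ-≤2 (s≤s z≤n)) (trans m≡m′ (sym (I′.conjβ-≤2 (s≤s z≤n))))
  conjβ≡ {1}             _   = trans (conjβ-≤2 ≤-refl) (trans m≡m′ (sym (I′.conjβ-≤2 ≤-refl)))
  conjβ≡ {2}             _   = β′₃≡
  conjβ≡ {suc (suc (suc i))} k<j = β′-upper≡ (m+n≤o⇒m≤o∸n (suc i) (subst (_≤ j) (cong suc (+-comm 3 i)) k<j))

  conj≡ : ∀ k → conj μ (suc k) ≡ conj μ′ (suc k)
  conj≡ k with suc k ≤? j | suc k ≤? w | suc k ≤? h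
  ... | yes k<j | _       | _       = trans (conj-left k<j) (trans (cong₂ _+_ j≡j′ (conjβ≡ k<j)) (sym (I′.conj-left (subst (suc k ≤_) j≡j′ k<j))))
  ... | no k≮j  | yes k<w | _       = trans (conj-middle (≰⇒> k≮j) k<w)
                                        (trans j≡j′ (sym (I′.conj-middle (subst (_< suc k) j≡j′ (≰⇒> k≮j)) (subst (suc k ≤_) w≡w′ k<w))))
  ... | no _    | no k≮w  | yes k<h = begin
    conj μ (suc k)             ≡⟨ cong (conj μ) (sym w+suc[k∸w]≡suc-k) ⟩
    conj μ (w + suc (k ∸ w))   ≡⟨ tail≡ k∸w<q ⟩
    conj μ′ (I′.w + suc (k ∸ w)) ≡⟨ cong (λ t → conj μ′ (t + suc (k ∸ w))) (sym w≡w′) ⟩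
    conj μ′ (w + suc (k ∸ w))  ≡⟨ cong (conj μ′) w+suc[k∸w]≡suc-k ⟩
    conj μ′ (suc k)            ∎
    where
    open ≡-Reasoning
    w+suc[k∸w]≡suc-k : w + suc (k ∸ w) ≡ suc k
    w+suc[k∸w]≡suc-k = trans (+-suc w (k ∸ w)) (cong suc (m+[n∸m]≡n (≤-pred (≰⇒> k≮w))))
    k∸w<q : k ∸ w < q
    k∸w<q = m+n≤o⇒m≤o∸n (suc (k ∸ w)) (subst (_≤ h) (trans (sym w+suc[k∸w]≡suc-k) (+-comm w _)) k<h)
  ... | no _    | no _    | no k≮h  = trans (conj-outside (≰⇒> k≮h)) (sym (I′.conj-outside (subst (_< suc k) h≡h′ (≰⇒> k≮h))))

  μ≡μ′ : μ ≡ μ′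
  μ≡μ′ = conj-injective sorted I′.sorted positive I′.positive conj≡

lemma5p5 : (n : ℕ) →
    Σ (List ℕ → List ℕ) (λ f →
    ((μ : List ℕ) → InQbar5 n μ → InP8 n (f μ)) ×
    ((μ ν : List ℕ) → InQbar5 n μ → InQbar5 n ν → f μ ≡ f ν → μ ≡ ν))
lemma5p5 n = image , (λ μ μ∈Q̄₅ → Image.image∈P8 (InQbar5⇒Q̄₅Shape μ∈Q̄₅))
                   , (λ μ μ′ μ∈Q̄₅ μ′∈Q̄₅ → Injective.μ≡μ′ (InQbar5⇒Q̄₅Shape μ∈Q̄₅) (InQbar5⇒Q̄₅Shape μ′∈Q̄₅))
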